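{- Let $\mathcal{C}$ be a category with pullbacks (with a fixed choice of pullback squares), $T=(T,\eta,\mu)$ a monad on $\mathcal{C}$ and $O$ an object. Then the forgetful functor $d\colon\mathcal{C}/O\to\mathcal{C}$ together with the family $\iota=(\iota_f)_{f\in\mathcal{C}/O}$ is an (oplax) monad morphism $(d,\iota)\colon(\mathcal{C}/O,\overline{T}_O)\to(\mathcal{C},T)$.
   Context: For $f\colon X\to O$, the object $\overline{T}_O(f)\colon\overline{T}_OX_f\to O$ of $\mathcal{C}/O$ and the morphism $\iota_f\colon\overline{T}_OX_f\to TX$ are given by the chosen pullback of $\eta_O\colon O\to TO$ along $Tf\colon TX\to TO$; $\overline{T}_O$ acts on morphisms by universality of the pullback. $\overline{T}_O$ is equipped with the monad structure induced by the adjunction $L_O\dashv R_O$, where $L_O\colon\mathcal{C}/O\to\mathcal{C}^T/(TO,\mu_O)$ sends $f\colon X\to O$ to $Tf\colon(TX,\mu_X)\to(TO,\mu_O)$ and $R_O$ sends an Eilenberg–Moore algebra morphism $h\colon(B,b)\to(TO,\mu_O)$ to the projection onto $O$ of the pullback of $\eta_O$ along $h$ (so $R_OL_O=\overline{T}_O$). An (oplax) monad morphism from a monad $(\mathcal{C}_1,S_1)$ to $(\mathcal{C}_2,S_2)$ is a functor $G\colon\mathcal{C}_1\to\mathcal{C}_2$ with a natural transformation $\psi\colon GS_1\Rightarrow S_2G$ such that $\psi_X\circ G(\eta^{S_1}_X)=\eta^{S_2}_{GX}$ and $\mu^{S_2}_{GX}\circ S_2\psi_X\circ\psi_{S_1X}=\psi_X\circ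 G(\mu^{S_1}_X)$ for all $X$. -}

module Defs where

open import Level using (Level; _⊔_) renaming (suc to lsuc)
open import Relation.Binary using (Rel; IsEquivalence)
import Relation.Binary.Reasoning.Setoid as SetoidR
open import Relation.Binary.Bundles using (Setoid)

record Category (o ℓ e : Level) : Set (lsuc (o ⊔ ℓ ⊔ e)) where
  infix  4 _≈_
  infixr 9 _∘_
  field
    Obj  : Set o
    _⇒_  : Obj → Obj → Set ℓ
    _≈_  : ∀ {A B} → Rel (A ⇒ B) e
    id   : ∀ {A} → A ⇒ A
    _∘_  : ∀ {A B C} → B ⇒ C → A ⇒ B → A ⇒ C
    equiv     : ∀ {A B} → IsEquivalence (_≈_ {A} {B})
    assoc     : ∀ {A B C D} {f : A ⇒ B} {g : B ⇒ C} {h : C ⇒ D} →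
                (h ∘ g) ∘ f ≈ h ∘ (g ∘ f)
    identityˡ : ∀ {A B} {f : A ⇒ B} → id ∘ f ≈ f
    identityʳ : ∀ {A B} {f : A ⇒ B} → f ∘ id ≈ f
    ∘-resp-≈  : ∀ {A B C} {f h : B ⇒ C} {g i : A ⇒ B} →
                f ≈ h → g ≈ i → f ∘ g ≈ h ∘ i

  hom-setoid : ∀ {A B} → Setoid ℓ e
  hom-setoid {A} {B} = record { Carrier = A ⇒ B ; _≈_ = _≈_ ; isEquivalence = equiv }

  module Equiv {A B : Obj} = IsEquivalence (equiv {A} {B})

record Functor {o ℓ e o′ ℓ′ e′} (C : Category o ℓ e) (D : Category o′ ℓ′ e′)
       : Set (o ⊔ ℓ ⊔ e ⊔ o′ ⊔ ℓ′ ⊔ e′) where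
  private
    module C = Category C
    module D = Category D
  field
    F₀ : C.Obj → D.Obj
    F₁ : ∀ {A B} → A C.⇒ B → F₀ A D.⇒ F₀ B
    identity     : ∀ {A} → F₁ (C.id {A}) D.≈ D.id
    homomorphism : ∀ {X Y Z} {f : X C.⇒ Y} {g : Y C.⇒ Z} →
                   F₁ (g C.∘ f) D.≈ F₁ g D.∘ F₁ f
    F-resp-≈     : ∀ {A B} {f g : A C.⇒ B} → f C.≈ g → F₁ f D.≈ F₁ g

record Monad {o ℓ e} (C : Category o ℓ e) : Set (o ⊔ ℓ ⊔ e) where
  open Category C
  field
    F : Functor C C
  open Functor F public
  field
    η : ∀ X → X ⇒ F₀ X
    μ : ∀ X → F₀ (F₀ X) ⇒ F₀ X
    η-natural : ∀ {X Y} (f : X ⇒ Y) → η Y ∘ f ≈ F₁ f ∘ η X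
    μ-natural : ∀ {X Y} (f : X ⇒ Y) → μ Y ∘ F₁ (F₁ f) ≈ F₁ f ∘ μ X
    assoc-μ   : ∀ {X} → μ X ∘ F₁ (μ X) ≈ μ X ∘ μ (F₀ X)
    identityˡ-μ : ∀ {X} → μ X ∘ F₁ (η X) ≈ id
    identityʳ-μ : ∀ {X} → μ X ∘ η (F₀ X) ≈ id

record Pullback {o ℓ e} (C : Category o ℓ e) {A B Z : Category.Obj C}
       (f : Category._⇒_ C A Z) (g : Category._⇒_ C B Z) : Set (o ⊔ ℓ ⊔ e) where
  open Category C
  field
    P  : Obj
    p₁ : P ⇒ A
    p₂ : P ⇒ B
    commute   : f ∘ p₁ ≈ g ∘ p₂
    universal : ∀ {Q} (h₁ : Q ⇒ A) (h₂ : Q ⇒ B) → f ∘ h₁ ≈ g ∘ h₂ → Q ⇒ P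
    p₁∘universal≈h₁ : ∀ {Q} {h₁ : Q ⇒ A} {h₂ : Q ⇒ B} {eq : f ∘ h₁ ≈ g ∘ h₂} →
                      p₁ ∘ universal h₁ h₂ eq ≈ h₁
    p₂∘universal≈h₂ : ∀ {Q} {h₁ : Q ⇒ A} {h₂ : Q ⇒ B} {eq : f ∘ h₁ ≈ g ∘ h₂} →
                      p₂ ∘ universal h₁ h₂ eq ≈ h₂
    unique : ∀ {Q} {h₁ : Q ⇒ A} {h₂ : Q ⇒ B} {eq : f ∘ h₁ ≈ g ∘ h₂} (i : Q ⇒ P) →
             p₁ ∘ i ≈ h₁ → p₂ ∘ i ≈ h₂ → i ≈ universal h₁ h₂ eq

HasPullbacks : ∀ {o ℓ e} → Category o ℓ e → Set (o ⊔ ℓ ⊔ e)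
HasPullbacks C = ∀ {A B Z : Obj} (f : A ⇒ Z) (g : B ⇒ Z) → Pullback C f g
  where open Category C

module _ {o ℓ e} (C : Category o ℓ e) (O : Category.Obj C) where
  open Category C

  record SliceObj : Set (o ⊔ ℓ) where
    constructor sliceobj
    field
      dom : Obj
      arr : dom ⇒ O

  record SliceHom (X Y : SliceObj) : Set (ℓ ⊔ e) where
    constructor slicehom
    field
      h : SliceObj.dom X ⇒ SliceObj.dom Y
      △ : SliceObj.arr Y ∘ h ≈ SliceObj.arr X

  Slice : Category (o ⊔ ℓ) (ℓ ⊔ e) e
  Slice = record
    { Obj = SliceObj
    ; _⇒_ = SliceHom
    ; _≈_ = λ u v → SliceHom.h u ≈ SliceHom.h v
    ; id  = λ {A} → slicehom id identityʳ
    ; _∘_ = λ {A} {B} {D} u v → slicehom (SliceHom.h u ∘ SliceHom.h v)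
              (let open SetoidR hom-setoid in begin
                 SliceObj.arr D ∘ (SliceHom.h u ∘ SliceHom.h v)
                   ≈⟨ Equiv.sym assoc ⟩
                 (SliceObj.arr D ∘ SliceHom.h u) ∘ SliceHom.h v
                   ≈⟨ ∘-resp-≈ (SliceHom.△ u) Equiv.refl ⟩
                 SliceObj.arr B ∘ SliceHom.h v
                   ≈⟨ SliceHom.△ v ⟩
                 SliceObj.arr A ∎)
    ; equiv = record { refl = Equiv.refl ; sym = Equiv.sym ; trans = Equiv.trans }
    ; assoc = assoc
    ; identityˡ = identityˡ
    ; identityʳ = identityʳ
    ; ∘-resp-≈ = ∘-resp-≈
    }

  forget : Functor Slice C
  forget = record
    { F₀ = SliceObj.dom
    ; F₁ = SliceHom.h
    ; identity = Equiv.refl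
    ; homomorphism = Equiv.refl
    ; F-resp-≈ = λ p → p
    }

-- The source "monad" is given by its structure maps (S₀, S₁, ηˢ, μˢ);
-- only these maps enter the definition.  ψ must be natural and satisfy
-- the unit and multiplication axioms.

record IsOplaxMonadMorphism {o ℓ e o′ ℓ′ e′}
       (C₁ : Category o ℓ e) (C₂ : Category o′ ℓ′ e′)
       (S₀ : Category.Obj C₁ → Category.Obj C₁)
       (S₁ : ∀ {A B} → Category._⇒_ C₁ A B → Category._⇒_ C₁ (S₀ A) (S₀ B))
       (ηˢ : ∀ X → Category._⇒_ C₁ X (S₀ X))
       (μˢ : ∀ X → Category._⇒_ C₁ (S₀ (S₀ X)) (S₀ X))
       (T : Monad C₂)
       (G : Functor C₁ C₂)
       (ψ : ∀ X → Category._⇒_ C₂ (Functor.F₀ G (S₀ X)) (Monad.F₀ T (Functor.F₀ G X)))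
       : Set (o ⊔ ℓ ⊔ e′) where
  private
    module C₁ = Category C₁
  open Category C₂
  open Functor G renaming (F₀ to G₀; F₁ to G₁)
  open Monad T renaming (F₀ to T₀; F₁ to T₁)
  field
    natural : ∀ {X Y} (f : X C₁.⇒ Y) → ψ Y ∘ G₁ (S₁ f) ≈ T₁ (G₁ f) ∘ ψ X
    unit    : ∀ X → ψ X ∘ G₁ (ηˢ X) ≈ η (G₀ X)
    mult    : ∀ X → μ (G₀ X) ∘ (T₁ (ψ X) ∘ ψ (S₀ X)) ≈ ψ X ∘ G₁ (μˢ X)

module Tbar {o ℓ e} (C : Category o ℓ e) (pb : HasPullbacks C)
            (T : Monad C) (O : Category.Obj C) where
  open Category C
  open Monad T renaming (F₀ to T₀; F₁ to T₁)

  PB : (f : SliceObj C O) → Pullback C (T₁ (SliceObj.arr f)) (η O)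
  PB f = pb (T₁ (SliceObj.arr f)) (η O)

  T̄₀ : SliceObj C O → SliceObj C O
  T̄₀ f = sliceobj (Pullback.P (PB f)) (Pullback.p₂ (PB f))

  ι : ∀ f → SliceObj.dom (T̄₀ f) ⇒ T₀ (SliceObj.dom f)
  ι f = Pullback.p₁ (PB f)

  T̄₁ : ∀ {f g} → SliceHom C O f g → SliceHom C O (T̄₀ f) (T̄₀ g)
  T̄₁ {f} {g} u = slicehom
      (Pullback.universal (PB g) (T₁ (SliceHom.h u) ∘ ι f) (Pullback.p₂ (PB f)) eq)
      (Pullback.p₂∘universal≈h₂ (PB g))
    where
    open SetoidR (hom-setoid {SliceObj.dom (T̄₀ f)} {T₀ O})
    eq : T₁ (SliceObj.arr g) ∘ (T₁ (SliceHom.h u) ∘ ι f) ≈ η O ∘ Pullback.p₂ (PB f)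
    eq = begin
      T₁ (SliceObj.arr g) ∘ (T₁ (SliceHom.h u) ∘ ι f) ≈⟨ Equiv.sym assoc ⟩
      (T₁ (SliceObj.arr g) ∘ T₁ (SliceHom.h u)) ∘ ι f ≈⟨ ∘-resp-≈ (Equiv.sym homomorphism) Equiv.refl ⟩
      T₁ (SliceObj.arr g ∘ SliceHom.h u) ∘ ι f        ≈⟨ ∘-resp-≈ (F-resp-≈ (SliceHom.△ u)) Equiv.refl ⟩
      T₁ (SliceObj.arr f) ∘ ι f                       ≈⟨ Pullback.commute (PB f) ⟩
      η O ∘ Pullback.p₂ (PB f) ∎

  -- unit of the monad R_O L_O induced by L_O ⊣ R_O (adjunction unit at f):
  -- the map X → T̄_O X_f induced by (η_X, f).
  η̄ : ∀ f → SliceHom C O f (T̄₀ f)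
  η̄ f = slicehom
      (Pullback.universal (PB f) (η (SliceObj.dom f)) (SliceObj.arr f)
         (Equiv.sym (η-natural (SliceObj.arr f))))
      (Pullback.p₂∘universal≈h₂ (PB f))

  -- multiplication of R_O L_O induced by L_O ⊣ R_O, i.e. R_O(ε_{L_O f}),
  -- where the counit at L_O f is  μ_X ∘ T ι_f : T(T̄_O X_f) → T X,
  -- and R_O acts on it by universality of the pullback.
  μ̄ : ∀ f → SliceHom C O (T̄₀ (T̄₀ f)) (T̄₀ f)
  μ̄ f = slicehom
      (Pullback.universal (PB f) (μ X ∘ (T₁ (ι f) ∘ ι g)) (Pullback.p₂ (PB g)) eq)
      (Pullback.p₂∘universal≈h₂ (PB f))
    where
    X = SliceObj.dom f
    g = T̄₀ f
    a = SliceObj.arr f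
    p = Pullback.p₂ (PB f)
    open SetoidR (hom-setoid {SliceObj.dom (T̄₀ g)} {T₀ O})
    eq : T₁ a ∘ (μ X ∘ (T₁ (ι f) ∘ ι g)) ≈ η O ∘ Pullback.p₂ (PB g)
    eq = begin
      T₁ a ∘ (μ X ∘ (T₁ (ι f) ∘ ι g))           ≈⟨ Equiv.sym assoc ⟩
      (T₁ a ∘ μ X) ∘ (T₁ (ι f) ∘ ι g)           ≈⟨ ∘-resp-≈ (Equiv.sym (μ-natural a)) Equiv.refl ⟩
      (μ O ∘ T₁ (T₁ a)) ∘ (T₁ (ι f) ∘ ι g)      ≈⟨ assoc ⟩
      μ O ∘ (T₁ (T₁ a) ∘ (T₁ (ι f) ∘ ι g))      ≈⟨ ∘-resp-≈ Equiv.refl (Equiv.sym assoc) ⟩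
      μ O ∘ ((T₁ (T₁ a) ∘ T₁ (ι f)) ∘ ι g)      ≈⟨ ∘-resp-≈ Equiv.refl (∘-resp-≈ (Equiv.sym homomorphism) Equiv.refl) ⟩
      μ O ∘ (T₁ (T₁ a ∘ ι f) ∘ ι g)             ≈⟨ ∘-resp-≈ Equiv.refl (∘-resp-≈ (F-resp-≈ (Pullback.commute (PB f))) Equiv.refl) ⟩
      μ O ∘ (T₁ (η O ∘ p) ∘ ι g)                ≈⟨ ∘-resp-≈ Equiv.refl (∘-resp-≈ homomorphism Equiv.refl) ⟩
      μ O ∘ ((T₁ (η O) ∘ T₁ p) ∘ ι g)           ≈⟨ ∘-resp-≈ Equiv.refl assoc ⟩
      μ O ∘ (T₁ (η O) ∘ (T₁ p ∘ ι g))           ≈⟨ Equiv.sym assoc ⟩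
      (μ O ∘ T₁ (η O)) ∘ (T₁ p ∘ ι g)           ≈⟨ ∘-resp-≈ identityˡ-μ Equiv.refl ⟩
      id ∘ (T₁ p ∘ ι g)                         ≈⟨ identityˡ ⟩
      T₁ p ∘ ι g                                ≈⟨ Pullback.commute (PB g) ⟩
      η O ∘ Pullback.p₂ (PB g) ∎

module Submission where

open import Defs

-- T̄₁ u, η̄ and μ̄ are the maps into the chosen pullbacks whose first legs are
-- T h ∘ ι, η and μ ∘ T ι ∘ ι; composing with ι (the first projection)
-- recovers these legs, which is exactly what the three axioms ask for.
proposition3p6 : ∀ {o ℓ e} (C : Category o ℓ e) (pb : HasPullbacks C)
    (T : Monad C) (O : Category.Obj C) →
    IsOplaxMonadMorphism (Slice C O) C
    (Tbar.T̄₀ C pb T O) (Tbar.T̄₁ C pb T O)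
    (Tbar.η̄ C pb T O) (Tbar.μ̄ C pb T O)
    T (forget C O) (Tbar.ι C pb T O)
proposition3p6 C pb T O = record
  { natural = λ {_} {g} _ → Pullback.p₁∘universal≈h₁ (PB g)
  ; unit    = λ f → Pullback.p₁∘universal≈h₁ (PB f)
  ; mult    = λ f → Equiv.sym (Pullback.p₁∘universal≈h₁ (PB f))
  }
  where
  open Category C using (module Equiv)
  open Tbar C pb T O using (PB)
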